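{- Let $G$ be a finite $2$-transitive permutation group with a regular normal subgroup $N$, and let $G_x$ be a point stabilizer. If $G/N\cong G_x$ is a simple group and there are derangements of $G$ outside $N$, then the derangement graph of $G$ is connected.
   Context: A derangement is a fixed-point-free element. The derangement graph of $G$ is the Cayley graph on $G$ whose connection set is the set of derangements of $G$. -}

module Defs where

open import Level using (Level; 0ℓ; suc)
open import Data.Nat using (ℕ)
open import Data.Fin using (Fin)
open import Data.Fin.Permutation using (Permutation′; _⟨$⟩ʳ_; _≈_; id; flip; _∘ₚ_)
open import Data.Product using (_×_; Σ; ∃; ∃-syntax; _,_)
open import Relation.Binary.PropositionalEquality using (_≡_; _≢_)
open import Relation.Binary.Construct.Closure.ReflexiveTransitive using (Star)
open import Relation.Nullary using (¬_)
open import Data.Sum using (_⊎_)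

-- Permutations of the finite set Fin n.  Note: (π ∘ₚ ρ) ⟨$⟩ʳ i = ρ ⟨$⟩ʳ (π ⟨$⟩ʳ i).
Perm : ℕ → Set
Perm n = Permutation′ n

PermSet : ℕ → Set₁
PermSet n = Perm n → Set

module _ {n : ℕ} where

  _⊆_ : PermSet n → PermSet n → Set
  H ⊆ K = ∀ g → H g → K g

  record IsPermGroup (H : PermSet n) : Set where
    field
      resp : ∀ {g h} → g ≈ h → H g → H h
      has-id : H id
      closed-∘ : ∀ {g h} → H g → H h → H (g ∘ₚ h)
      closed-inv : ∀ {g} → H g → H (flip g)

  IsSubgroup : PermSet n → PermSet n → Set
  IsSubgroup H K = IsPermGroup H × (H ⊆ K)

  IsNormalSubgroup : PermSet n → PermSet n → Set
  IsNormalSubgroup H K =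
    IsSubgroup H K × (∀ k h → K k → H h → H ((flip k ∘ₚ h) ∘ₚ k))

  IsTrivial : PermSet n → Set
  IsTrivial H = ∀ h → H h → h ≈ id

  IsSimple : PermSet n → Set₁
  IsSimple K =
    ¬ IsTrivial K ×
    (∀ (H : PermSet n) → IsNormalSubgroup H K → IsTrivial H ⊎ (K ⊆ H))

  IsTransitive : PermSet n → Set
  IsTransitive G = ∀ x y → ∃[ g ] (G g × g ⟨$⟩ʳ x ≡ y)

  Is2Transitive : PermSet n → Set
  Is2Transitive G =
    ∀ x y x′ y′ → x ≢ y → x′ ≢ y′ →
      ∃[ g ] (G g × g ⟨$⟩ʳ x ≡ x′ × g ⟨$⟩ʳ y ≡ y′)

  IsRegular : PermSet n → Set
  IsRegular N = IsTransitive N × (∀ g x → N g → g ⟨$⟩ʳ x ≡ x → g ≈ id)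

  Stabilizer : PermSet n → Fin n → PermSet n
  Stabilizer G x g = G g × g ⟨$⟩ʳ x ≡ x

  IsDerangement : Perm n → Set
  IsDerangement g = ∀ x → g ⟨$⟩ʳ x ≢ x

  -- Derangement graph of G: Cayley graph Cay(G, D), D = derangements in G;
  -- g ~ h iff g, h ∈ G and h g⁻¹ ∈ D  (h g⁻¹ is "apply g⁻¹, then h")
  DerangementAdj : PermSet n → Perm n → Perm n → Set
  DerangementAdj G g h =
    G g × G h × G (flip g ∘ₚ h) × IsDerangement (flip g ∘ₚ h)

  DerangementGraphConnected : PermSet n → Set
  DerangementGraphConnected G =
    ∀ g h → G g → G h → Star (DerangementAdj G) g h

module Submission where

-- Let D be the set of derangements of G.  The vertices of the derangement
-- graph Cay(G, D) reachable from the identity form a subgroup C of G (it is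
-- the subgroup generated by D), and C is normal because D is closed under
-- conjugation.  The graph is connected iff C = G.
--
-- The group-theoretic heart is a general fact: if N is a transitive subgroup
-- of G, the point stabilizer G_x is simple, and C is a normal subgroup of G
-- with N ⊆ C ⊈ N, then C = G.  Indeed G = G_x N, and C ∩ G_x is normal in
-- G_x; if it is all of G_x then C ⊇ G_x N = G, and if it is trivial then an
-- element g = s m ∈ C ∖ N (s ∈ G_x, m ∈ N) has s = g m⁻¹ ∈ C ∩ G_x, so
-- g = m ∈ N, a contradiction.

open import Defs
open import Data.Nat using (ℕ)
open import Data.Fin using (Fin)
open import Data.Fin.Properties using (any?) renaming (_≟_ to _≟ᶠ_)
open import Data.Fin.Permutation
  using (_⟨$⟩ʳ_; _⟨$⟩ˡ_; inverseˡ; inverseʳ; id; flip; _∘ₚ_)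
  renaming (_≈_ to _≈ₚ_)
open import Data.Product using (_×_; ∃-syntax; _,_; proj₁; proj₂)
open import Data.Sum using (_⊎_; inj₁; inj₂)
open import Relation.Nullary using (¬_; yes; no; contradiction)
open import Relation.Binary.PropositionalEquality
  using (_≡_; refl; sym; trans; cong)
open import Relation.Binary.Construct.Closure.ReflexiveTransitive
  using (Star; ε; _◅_; _◅◅_; gmap; reverse)

module _ {n : ℕ} where

  conj : Perm n → Perm n → Perm n
  conj k a = (flip k ∘ₚ a) ∘ₚ k

  factor-through : ∀ (h m : Perm n) → h ≈ₚ ((h ∘ₚ flip m) ∘ₚ m)
  factor-through h m i = sym (inverseʳ m)

  fixed-by-inverse : ∀ {g : Perm n} {y} → g ⟨$⟩ʳ y ≡ y → flip g ⟨$⟩ʳ y ≡ y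
  fixed-by-inverse {g} gy = trans (cong (g ⟨$⟩ˡ_) (sym gy)) (inverseˡ g)

  derangement-resp : ∀ {g h : Perm n} → g ≈ₚ h → IsDerangement g → IsDerangement h
  derangement-resp g≈h dg i hi = dg i (trans (g≈h i) hi)

  derangement-inv : ∀ {g : Perm n} → IsDerangement g → IsDerangement (flip g)
  derangement-inv {g} dg i gi = dg i (trans (cong (g ⟨$⟩ʳ_) (sym gi)) (inverseʳ g))

  derangement-conj : ∀ (k : Perm n) {d : Perm n} → IsDerangement d → IsDerangement (conj k d)
  derangement-conj k dd i e = dd (k ⟨$⟩ˡ i) (trans (sym (inverseˡ k)) (cong (k ⟨$⟩ˡ_) e))

  -- Fixed points are decidable on a finite set, so every permutation either
  -- fixes a point or is a derangement.
  fixes-point-or-derangement :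
    ∀ (g : Perm n) → (∃[ i ] g ⟨$⟩ʳ i ≡ i) ⊎ IsDerangement g
  fixes-point-or-derangement g with any? (λ i → g ⟨$⟩ʳ i ≟ᶠ i)
  ... | yes fixed = inj₁ fixed
  ... | no ¬fixed = inj₂ λ i gi → ¬fixed (i , gi)

  _∩_ : PermSet n → PermSet n → PermSet n
  (H ∩ K) g = H g × K g

  stabilizer-subgroup : ∀ {G : PermSet n} → IsPermGroup G → ∀ x → IsSubgroup (Stabilizer G x) G
  stabilizer-subgroup isG x = record
    { resp = λ g≈h (Gg , gx) → resp g≈h Gg , trans (sym (g≈h x)) gx
    ; has-id = has-id , refl
    ; closed-∘ = λ {g} {h} (Gg , gx) (Gh , hx) →
        closed-∘ Gg Gh , trans (cong (h ⟨$⟩ʳ_) gx) hx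
    ; closed-inv = λ {g} (Gg , gx) → closed-inv Gg , fixed-by-inverse {g} gx
    } , λ _ → proj₁
    where open IsPermGroup isG

  normal-∩-subgroup : ∀ {G K S : PermSet n} →
    IsNormalSubgroup K G → IsSubgroup S G → IsNormalSubgroup (S ∩ K) S
  normal-∩-subgroup ((isK , K⊆G) , K-normal) (isS , S⊆G) =
    (record
      { resp = λ g≈h (Sg , Kg) → S.resp g≈h Sg , K.resp g≈h Kg
      ; has-id = S.has-id , K.has-id
      ; closed-∘ = λ (Sg , Kg) (Sh , Kh) → S.closed-∘ Sg Sh , K.closed-∘ Kg Kh
      ; closed-inv = λ (Sg , Kg) → S.closed-inv Sg , K.closed-inv Kg
      } , λ _ → proj₁) ,
    λ k h Sk (Sh , Kh) →
      S.closed-∘ (S.closed-∘ (S.closed-inv Sk) Sh) Sk , K-normal k h (S⊆G k Sk) Kh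
    where
    module S = IsPermGroup isS
    module K = IsPermGroup isK

  -- G = G_x N for a transitive subgroup N ⊆ G: every h ∈ G is s m with
  -- m ∈ N (chosen so that m x = h x) and s = h m⁻¹ in the stabilizer G_x.
  transitive-factorisation : ∀ {G N : PermSet n} → IsPermGroup G → IsSubgroup N G →
    IsTransitive N → ∀ x {h} → G h →
    ∃[ m ] (N m × Stabilizer G x (h ∘ₚ flip m))
  transitive-factorisation isG (_ , N⊆G) N-trans x {h} Gh
    with N-trans x (h ⟨$⟩ʳ x)
  ... | m , Nm , mx≡hx =
    m , Nm ,
    IsPermGroup.closed-∘ isG Gh (IsPermGroup.closed-inv isG (N⊆G m Nm)) ,
    trans (cong (m ⟨$⟩ˡ_) (sym mx≡hx)) (inverseˡ m)

  normal-above-transitive-is-everything : ∀ {G N C : PermSet n} x →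
    IsPermGroup G → IsSubgroup N G → IsTransitive N →
    IsSimple (Stabilizer G x) → IsNormalSubgroup C G → N ⊆ C →
    (∃[ g ] (C g × ¬ N g)) → G ⊆ C
  normal-above-transitive-is-everything {G} {N} {C} x isG N≤G N-trans
    (_ , stabilizer-simple) C⊴G N⊆C C⊈N h Gh
    with stabilizer-simple (Stabilizer G x ∩ C)
           (normal-∩-subgroup C⊴G (stabilizer-subgroup isG x))
  ... | inj₂ Gₓ⊆C
    with transitive-factorisation isG N≤G N-trans x Gh
  ... | m , Nm , Gₓs =
    C.resp (λ i → sym (factor-through h m i))
           (C.closed-∘ (proj₂ (Gₓ⊆C _ Gₓs)) (N⊆C m Nm))
    where module C = IsPermGroup (proj₁ (proj₁ C⊴G))
  normal-above-transitive-is-everything {G} {N} {C} x isG N≤G N-trans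
    _ C⊴G N⊆C (g , Cg , g∉N) h Gh
    | inj₁ Gₓ∩C-trivial
    with transitive-factorisation isG N≤G N-trans x (proj₂ (proj₁ C⊴G) g Cg)
  ... | m , Nm , Gₓs = contradiction (N.resp m≈g Nm) g∉N
    where
    module C = IsPermGroup (proj₁ (proj₁ C⊴G))
    module N = IsPermGroup (proj₁ N≤G)
    s≈id : (g ∘ₚ flip m) ≈ₚ id
    s≈id = Gₓ∩C-trivial _ (Gₓs , C.closed-∘ Cg (C.closed-inv (N⊆C m Nm)))
    m≈g : m ≈ₚ g
    m≈g i = sym (trans (factor-through g m i) (cong (m ⟨$⟩ʳ_) (s≈id i)))

module DerangementGraph {n : ℕ} {G : PermSet n} (isG : IsPermGroup G) where
  open IsPermGroup isG

  Adj : Perm n → Perm n → Set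
  Adj = DerangementAdj G

  adjacent : ∀ {a b} d → G a → G b → G d → IsDerangement d →
    d ≈ₚ (flip a ∘ₚ b) → Adj a b
  adjacent {a} {b} d Ga Gb Gd dd d≈ =
    Ga , Gb , resp {d} {flip a ∘ₚ b} d≈ Gd ,
    derangement-resp {g = d} {h = flip a ∘ₚ b} d≈ dd

  adjacent-sym : ∀ {a b} → Adj a b → Adj b a
  adjacent-sym {a} {b} (Ga , Gb , Gd , dd) =
    adjacent (flip (flip a ∘ₚ b)) Gb Ga (closed-inv Gd)
      (derangement-inv {g = flip a ∘ₚ b} dd) (λ _ → refl)

  adjacent-translate : ∀ {k} → G k → ∀ {a b} → Adj a b → Adj (k ∘ₚ a) (k ∘ₚ b)
  adjacent-translate {k} Gk {a} {b} (Ga , Gb , Gd , dd) =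
    adjacent (flip a ∘ₚ b) (closed-∘ Gk Ga) (closed-∘ Gk Gb) Gd dd
      (λ i → cong (b ⟨$⟩ʳ_) (sym (inverseʳ k)))

  closed-conj : ∀ {k a} → G k → G a → G (conj k a)
  closed-conj Gk Ga = closed-∘ (closed-∘ (closed-inv Gk) Ga) Gk

  adjacent-conj : ∀ {k} → G k → ∀ {a b} → Adj a b → Adj (conj k a) (conj k b)
  adjacent-conj {k} Gk {a} {b} (Ga , Gb , Gd , dd) =
    adjacent (conj k (flip a ∘ₚ b))
      (closed-conj Gk Ga) (closed-conj Gk Gb) (closed-conj Gk Gd)
      (derangement-conj k {d = flip a ∘ₚ b} dd)
      (λ i → cong (λ j → k ⟨$⟩ʳ (b ⟨$⟩ʳ j)) (sym (inverseˡ k)))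

  Component : PermSet n
  Component h = G h × Star Adj id h

  derangement-in-component : ∀ {d} → G d → IsDerangement d → Component d
  derangement-in-component {d} Gd dd = Gd , adjacent d has-id Gd Gd dd (λ _ → refl) ◅ ε

  -- Given one derangement d₀ ∈ G, ≈-equal elements a ≈ b are joined by the
  -- walk a ~ a d₀ ~ b; this is what makes the component respect ≈.
  module _ {d₀ : Perm n} (Gd₀ : G d₀) (dd₀ : IsDerangement d₀) where

    walk-≈ : ∀ {a b} → G a → G b → a ≈ₚ b → Star Adj a b
    walk-≈ {a} Ga Gb a≈b =
      adjacent d₀ Ga Gad₀ Gd₀ dd₀ (λ _ → cong (d₀ ⟨$⟩ʳ_) (sym (inverseʳ a))) ◅
      adjacent (flip d₀) Gad₀ Gb (closed-inv Gd₀) (derangement-inv {g = d₀} dd₀)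
        (λ _ → sym (trans (sym (a≈b _)) (inverseʳ a))) ◅ ε
      where Gad₀ = closed-∘ Ga Gd₀

    -- The component is a subgroup: id ⇝ a followed by the a-translate of
    -- id ⇝ b reaches a b, and the reversed a⁻¹-translate of id ⇝ a joins
    -- a⁻¹ a ≈ id to a⁻¹.
    component-subgroup : IsPermGroup Component
    component-subgroup = record
      { resp = λ a≈b (Ga , walk) → resp a≈b Ga , walk ◅◅ walk-≈ Ga (resp a≈b Ga) a≈b
      ; has-id = has-id , ε
      ; closed-∘ = λ {a} (Ga , walk-a) (Gb , walk-b) →
          closed-∘ Ga Gb , walk-a ◅◅ gmap (a ∘ₚ_) (adjacent-translate Ga) walk-b
      ; closed-inv = λ {a} (Ga , walk-a) →
          closed-inv Ga ,
          walk-≈ has-id (closed-∘ (closed-inv Ga) Ga) (λ _ → sym (inverseʳ a)) ◅◅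
          reverse adjacent-sym
            (gmap (flip a ∘ₚ_) (adjacent-translate (closed-inv Ga)) walk-a)
      }

    -- It is normal: the k-conjugate of id ⇝ h joins k⁻¹ id k ≈ id to k⁻¹ h k.
    component-normal : IsNormalSubgroup Component G
    component-normal =
      (component-subgroup , λ _ → proj₁) ,
      λ k h Gk (Gh , walk-h) →
        closed-conj Gk Gh ,
        walk-≈ has-id (closed-conj Gk has-id) (λ _ → sym (inverseʳ k)) ◅◅
        gmap (conj k) (adjacent-conj Gk) walk-h

  spanning-component-connected : G ⊆ Component → DerangementGraphConnected G
  spanning-component-connected G⊆C g h Gg Gh =
    reverse adjacent-sym (proj₂ (G⊆C g Gg)) ◅◅ proj₂ (G⊆C h Gh)

-- In a regular subgroup N every non-identity element is a derangement, so
-- N lies in the identity component of the derangement graph of G ⊇ N.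
regular-in-component : ∀ {n} {G N : PermSet n} (isG : IsPermGroup G) {d₀} →
  G d₀ → IsDerangement d₀ → N ⊆ G → IsRegular N →
  N ⊆ DerangementGraph.Component isG
regular-in-component isG Gd₀ dd₀ N⊆G (_ , N-semiregular) m Nm
  with fixes-point-or-derangement m
... | inj₁ (i , mi) = C.resp (λ j → sym (N-semiregular m i Nm mi j)) C.has-id
  where module C = IsPermGroup (DerangementGraph.component-subgroup isG Gd₀ dd₀)
... | inj₂ dm = DerangementGraph.derangement-in-component isG (N⊆G m Nm) dm

lemma5p3 : ∀ (n : ℕ) (G N : PermSet n) (x : Fin n) →
    IsPermGroup G →
    Is2Transitive G →
    IsNormalSubgroup N G →
    IsRegular N →
    IsSimple (Stabilizer G x) →
    (∃[ g ] (G g × ¬ N g × IsDerangement g)) →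
    DerangementGraphConnected G
lemma5p3 n G N x isG _ (N≤G , _) N-regular stabilizer-simple (g , Gg , g∉N , dg) =
  spanning-component-connected
    (normal-above-transitive-is-everything x isG N≤G (proj₁ N-regular)
      stabilizer-simple (component-normal Gg dg)
      (regular-in-component isG Gg dg (proj₂ N≤G) N-regular)
      (g , derangement-in-component Gg dg , g∉N))
  where open DerangementGraph isG
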